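{- Let $G$ be a $3$-graph on $n$ vertices with $4\mid n$ and $\delta(G)\ge 3n/4-1$. Let $(A,B)$ be a partition of $V(G)$ with $3n/16<|A|<5n/16$. Then $G$ contains a copy of $K^3_4$ with an odd number of vertices in each of $A$ and $B$.
   Context: For a $3$-graph $G$, $\delta(G)$ is the largest $m$ such that every pair of vertices lies in at least $m$ edges. A copy of $K^3_4$ in $G$ is a $4$-set of vertices all of whose $3$-subsets are edges of $G$. -}

module Defs where

open import Data.Nat using (ℕ; _+_; _*_)
open import Data.Bool using (Bool; true; false; if_then_else_; not)
open import Data.Fin using (Fin)
open import Data.List using (List; filterᵇ; length; allFin)
open import Data.Product using (_×_; ∃)
open import Relation.Binary.PropositionalEquality using (_≡_; _≢_)

-- A 3-graph on vertex set Fin n: a Boolean edge indicator on ordered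
-- triples which is invariant under permutations and only true on
-- triples of pairwise distinct vertices (so edges are 3-sets).
record Graph3 (n : ℕ) : Set where
  field
    edge     : Fin n → Fin n → Fin n → Bool
    sym₁₂    : ∀ x y z → edge x y z ≡ edge y x z
    sym₂₃    : ∀ x y z → edge x y z ≡ edge x z y
    distinct : ∀ x y z → edge x y z ≡ true → (x ≢ y) × (y ≢ z) × (x ≢ z)
open Graph3 public

codeg : ∀ {n} → Graph3 n → Fin n → Fin n → ℕ
codeg G u v = length (filterᵇ (λ w → edge G u v w) (allFin _))

_≤δ_ : ∀ {n} → ℕ → Graph3 n → Set
m ≤δ G = ∀ u v → u ≢ v → Data.Nat._≤_ m (codeg G u v)

size : ∀ {n} → (Fin n → Bool) → ℕ
size {n} A = length (filterᵇ A (allFin n))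

IsK4 : ∀ {n} → Graph3 n → Fin n → Fin n → Fin n → Fin n → Set
IsK4 G a b c d =
  (a ≢ b) × (a ≢ c) × (a ≢ d) × (b ≢ c) × (b ≢ d) × (c ≢ d) ×
  (edge G a b c ≡ true) × (edge G a b d ≡ true) ×
  (edge G a c d ≡ true) × (edge G b c d ≡ true)

count4 : ∀ {n} → (Fin n → Bool) → Fin n → Fin n → Fin n → Fin n → ℕ
count4 A a b c d = ind (A a) + ind (A b) + ind (A c) + ind (A d)
  where
  ind : Bool → ℕ
  ind b = if b then 1 else 0

count4B : ∀ {n} → (Fin n → Bool) → Fin n → Fin n → Fin n → Fin n → ℕ
count4B A = count4 (λ v → not (A v))

Odd : ℕ → Set
Odd k = ∃ λ j → k ≡ 1 + 2 * j

-- Write n = 4k and suppose that no K₄ has exactly one vertex on one side of (A, B).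
-- By the codegree condition every pair misses at most k + 1 vertices.  If pqw is an
-- edge and no vertex of R extends pqw to such a K₄, then the vertices of R in N(p,q)
-- lying in N(p,w) all miss N(q,w); counting non-neighbours of (p,w) and (q,w) gives
-- |N(p,q) ∩ R| ≤ 2k − 1, and ≤ 2k − 2 if w ∉ R.  For x ∈ A and y ∈ B this yields
-- |N(x,y) ∩ B| ≤ 2k − 1, hence |N(x,y) ∩ A| ≥ k.  A pair x, x′ ∈ A lying in an edge
-- with some y ∈ B then lies in no edge inside A, for otherwise |A| ≥ (3k + 3)/2 > 5k/4;
-- so A misses N(x,x′) and |A| ≤ k + 1.  Finally, a pair y, z ∈ B with xyz ∉ G lies in
-- an edge with some v ∈ A, and the bound for w = v gives |N(y,z) ∩ A| ≥ k + 1 ≥ |A|,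
-- although x ∈ A misses N(y,z).

module Submission where

open import Defs
open import Data.Nat using (ℕ; zero; suc; _+_; _*_; _<_; _≤_; z≤n; s≤s; s≤s⁻¹; z<s)
open import Data.Nat.Properties hiding (_≟_)
open import Data.Nat.Divisibility using (_∣_; divides)
open import Data.Nat.Tactic.RingSolver using (solve; solve-∀)
open import Data.Bool using (Bool; true; false; not; _∧_)
import Data.Bool.Properties as Bool
open import Data.Fin using (Fin; _≟_)
open import Data.Fin.Properties using (any?)
open import Data.List using (List; []; _∷_; length; filterᵇ; allFin)
open import Data.List.Properties using (length-tabulate)
import Data.List.Membership.Propositional as List
open import Data.List.Membership.Propositional.Properties using (∈-allFin)
open import Data.List.Relation.Unary.Any using (here; there)
open import Data.List.Relation.Unary.All as All using (All)
import Data.List.Relation.Unary.AllPairs as AllPairs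
open import Data.List.Relation.Unary.Unique.Propositional using (Unique)
open import Data.List.Relation.Unary.Unique.Propositional.Properties using (allFin⁺)
open import Data.Product using (∃; _×_; _,_; proj₁; proj₂)
open import Data.Empty using (⊥; ⊥-elim)
open import Function using (id)
open import Relation.Nullary using (¬_; Dec; does; yes; no; contradiction)
open import Relation.Nullary.Decidable using (dec-true; dec-false; map′; ¬?; _×-dec_)
open import Relation.Binary.PropositionalEquality

module _ {X : Set} where

  infix  4 _∈_ _∉_ _⊆_
  infixl 7 _∩_ _∖_

  -- Membership is a record and ∁, _∩_ and count are opaque, so that the sets in
  -- membership and size statements are recovered by unification.
  record _∈_ (x : X) (P : X → Bool) : Set where
    constructor ≡true⇒∈
    field ∈⇒≡true : P x ≡ true
  open _∈_ public

  _∉_ : X → (X → Bool) → Set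
  x ∉ P = ¬ x ∈ P

  _⊆_ : (X → Bool) → (X → Bool) → Set
  P ⊆ Q = ∀ {x} → x ∈ P → x ∈ Q

  ≡false⇒∉ : ∀ {P x} → P x ≡ false → x ∉ P
  ≡false⇒∉ Px≡false (≡true⇒∈ Px≡true) = contradiction (trans (sym Px≡false) Px≡true) λ ()

  ∉⇒≡false : ∀ {P x} → x ∉ P → P x ≡ false
  ∉⇒≡false {P} {x} x∉P with P x in Px
  ... | true  = contradiction (≡true⇒∈ Px) x∉P
  ... | false = refl

  opaque
    ∁ : (X → Bool) → X → Bool
    ∁ P x = not (P x)

    _∩_ : (X → Bool) → (X → Bool) → X → Bool
    (P ∩ Q) x = P x ∧ Q x

  _∖_ : (X → Bool) → (X → Bool) → X → Bool
  P ∖ Q = P ∩ ∁ Q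

  opaque
    unfolding ∁ _∩_

    ∁⁺ : ∀ {P x} → x ∉ P → x ∈ ∁ P
    ∁⁺ x∉P = ≡true⇒∈ (cong not (∉⇒≡false x∉P))

    ∁⁻ : ∀ {P x} → x ∈ ∁ P → x ∉ P
    ∁⁻ (≡true⇒∈ ¬Px) (≡true⇒∈ Px) = contradiction (trans (sym ¬Px) (cong not Px)) λ ()

    ∩⁺ : ∀ {P Q x} → x ∈ P → x ∈ Q → x ∈ P ∩ Q
    ∩⁺ (≡true⇒∈ Px) (≡true⇒∈ Qx) = ≡true⇒∈ (cong₂ _∧_ Px Qx)

    ∩⁻ˡ : ∀ {P Q x} → x ∈ P ∩ Q → x ∈ P
    ∩⁻ˡ {P} {x = x} (≡true⇒∈ PQx) with P x in Px
    ... | true = ≡true⇒∈ Px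

    ∩⁻ʳ : ∀ {P Q x} → x ∈ P ∩ Q → x ∈ Q
    ∩⁻ʳ {P} {x = x} (≡true⇒∈ PQx) with P x
    ... | true = ≡true⇒∈ PQx

  opaque
    count : (X → Bool) → List X → ℕ
    count P xs = length (filterᵇ P xs)

  opaque
    unfolding count ∁ _∩_

    count-split : ∀ P Q xs → count P xs ≡ count (P ∩ Q) xs + count (P ∖ Q) xs
    count-split P Q [] = refl
    count-split P Q (x ∷ xs) with P x | Q x
    ... | true  | true  = cong suc (count-split P Q xs)
    ... | true  | false = trans (cong suc (count-split P Q xs)) (sym (+-suc _ _))
    ... | false | _     = count-split P Q xs

    count-complement : ∀ P xs → count P xs + count (∁ P) xs ≡ length xs
    count-complement P [] = refl
    count-complement P (x ∷ xs) with P x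
    ... | true  = cong suc (count-complement P xs)
    ... | false = trans (+-suc _ _) (cong suc (count-complement P xs))

    count-mono : ∀ {P Q} → P ⊆ Q → ∀ xs → count P xs ≤ count Q xs
    count-mono {P} {Q} P⊆Q [] = z≤n
    count-mono {P} {Q} P⊆Q (x ∷ xs) with P x in Px | Q x in Qx
    ... | true  | true  = s≤s (count-mono P⊆Q xs)
    ... | true  | false = contradiction (P⊆Q (≡true⇒∈ Px)) (≡false⇒∉ Qx)
    ... | false | true  = m≤n⇒m≤1+n (count-mono P⊆Q xs)
    ... | false | false = count-mono P⊆Q xs

    count-pos : ∀ {P x xs} → x List.∈ xs → x ∈ P → 0 < count P xs
    count-pos {P} {xs = y ∷ xs} (here refl) (≡true⇒∈ Px) rewrite Px = s≤s z≤n
    count-pos {P} {xs = y ∷ xs} (there x∈xs) x∈P with P y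
    ... | true  = s≤s z≤n
    ... | false = count-pos x∈xs x∈P

    count-witness : ∀ {P} xs → 0 < count P xs → ∃ (_∈ P)
    count-witness {P} (x ∷ xs) 0<c with P x in Px
    ... | true  = x , ≡true⇒∈ Px
    ... | false = count-witness xs 0<c

    count-none : ∀ {P} xs → All (_∉ P) xs → count P xs ≡ 0
    count-none []       All.[]             = refl
    count-none (x ∷ xs) (x∉P All.∷ xs∉P) rewrite ∉⇒≡false x∉P = count-none xs xs∉P

  ∩-comm-⊆ : ∀ {P Q} → P ∩ Q ⊆ Q ∩ P
  ∩-comm-⊆ x∈P∩Q = ∩⁺ (∩⁻ʳ x∈P∩Q) (∩⁻ˡ x∈P∩Q)

module _ {n : ℕ} where

  ∣_∣ : (Fin n → Bool) → ℕ
  ∣ P ∣ = count P (allFin n)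

  ⦅_⦆ : Fin n → Fin n → Bool
  ⦅ y ⦆ x = does (y ≟ x)

  ∈⦅⦆ : ∀ y → y ∈ ⦅ y ⦆
  ∈⦅⦆ y = ≡true⇒∈ (dec-true (y ≟ y) refl)

  ∉⦅⦆ : ∀ {x y} → y ≢ x → x ∉ ⦅ y ⦆
  ∉⦅⦆ {x} {y} y≢x = ≡false⇒∉ (dec-false (y ≟ x) y≢x)

  ∉⦅⦆⇒≢ : ∀ {x y} → x ∉ ⦅ y ⦆ → y ≢ x
  ∉⦅⦆⇒≢ {x} x∉⦅y⦆ refl = x∉⦅y⦆ (∈⦅⦆ x)

  opaque
    unfolding count

    size≡∣∣ : ∀ P → size P ≡ ∣ P ∣
    size≡∣∣ P = refl

    count-⦅⦆ : ∀ y {xs} → Unique xs → count ⦅ y ⦆ xs ≤ 1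
    count-⦅⦆ y AllPairs.[] = z≤n
    count-⦅⦆ y {x ∷ xs} (x≢xs AllPairs.∷ xs-unique) with y ≟ x
    ... | yes refl = s≤s (≤-reflexive (count-none xs (All.map ∉⦅⦆ x≢xs)))
    ... | no _     = count-⦅⦆ y xs-unique

  size-split : ∀ (P Q : Fin n → Bool) → ∣ P ∣ ≡ ∣ P ∩ Q ∣ + ∣ P ∖ Q ∣
  size-split P Q = count-split P Q (allFin n)

  size-complement : ∀ (P : Fin n → Bool) → ∣ P ∣ + ∣ ∁ P ∣ ≡ n
  size-complement P = trans (count-complement P (allFin n)) (length-tabulate id)

  size-mono : ∀ {P Q : Fin n → Bool} → P ⊆ Q → ∣ P ∣ ≤ ∣ Q ∣
  size-mono P⊆Q = count-mono P⊆Q (allFin n)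

  size-∩-comm : ∀ (P Q : Fin n → Bool) → ∣ P ∩ Q ∣ ≡ ∣ Q ∩ P ∣
  size-∩-comm P Q = ≤-antisym (size-mono ∩-comm-⊆) (size-mono ∩-comm-⊆)

  size-pos : ∀ {P : Fin n → Bool} {x} → x ∈ P → 0 < ∣ P ∣
  size-pos {x = x} = count-pos (∈-allFin x)

  size-witness : ∀ {P : Fin n → Bool} → 0 < ∣ P ∣ → ∃ (_∈ P)
  size-witness = count-witness (allFin n)

  size-⦅⦆ : ∀ y → ∣ ⦅ y ⦆ ∣ ≤ 1
  size-⦅⦆ y = count-⦅⦆ y (allFin⁺ n)

  size-≥2 : ∀ {P : Fin n → Bool} {x y} → x ∈ P → y ∈ P → x ≢ y → 2 ≤ ∣ P ∣
  size-≥2 {P} {x} x∈P y∈P x≢y = begin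
    2                              ≤⟨ +-mono-≤ (size-pos x∈P∩⦅x⦆) (size-pos y∈P∖⦅x⦆) ⟩
    ∣ P ∩ ⦅ x ⦆ ∣ + ∣ P ∖ ⦅ x ⦆ ∣  ≡⟨ size-split P ⦅ x ⦆ ⟨
    ∣ P ∣                          ∎
    where
    open ≤-Reasoning
    x∈P∩⦅x⦆ = ∩⁺ x∈P (∈⦅⦆ x)
    y∈P∖⦅x⦆ = ∩⁺ y∈P (∁⁺ (∉⦅⦆ x≢y))

  size-≥2⇒other : ∀ {P : Fin n → Bool} y → 2 ≤ ∣ P ∣ → ∃ λ z → z ∈ P × y ≢ z
  size-≥2⇒other {P} y 2≤P = z , ∩⁻ˡ z∈P∖y , ∉⦅⦆⇒≢ (∁⁻ (∩⁻ʳ z∈P∖y))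
    where
    0<P∖y : 0 < ∣ P ∖ ⦅ y ⦆ ∣
    0<P∖y = +-cancelˡ-≤ 1 1 _ (begin
      2                              ≤⟨ 2≤P ⟩
      ∣ P ∣                          ≡⟨ size-split P ⦅ y ⦆ ⟩
      ∣ P ∩ ⦅ y ⦆ ∣ + ∣ P ∖ ⦅ y ⦆ ∣  ≤⟨ +-monoˡ-≤ _ (≤-trans (size-mono ∩⁻ʳ) (size-⦅⦆ y)) ⟩
      1 + ∣ P ∖ ⦅ y ⦆ ∣              ∎)
      where open ≤-Reasoning
    z = proj₁ (size-witness 0<P∖y)
    z∈P∖y = proj₂ (size-witness 0<P∖y)

  size-∩-< : ∀ {P Q : Fin n → Bool} {x} → x ∉ P → x ∈ Q → ∣ P ∩ Q ∣ < ∣ Q ∣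
  size-∩-< {P} {Q} x∉P x∈Q = begin-strict
    ∣ P ∩ Q ∣              ≡⟨ size-∩-comm P Q ⟩
    ∣ Q ∩ P ∣              <⟨ m<m+n _ (size-pos (∩⁺ x∈Q (∁⁺ x∉P))) ⟩
    ∣ Q ∩ P ∣ + ∣ Q ∖ P ∣  ≡⟨ size-split Q P ⟨
    ∣ Q ∣                  ∎
    where open ≤-Reasoning

  size-∩-<₂ : ∀ {P Q : Fin n → Bool} {x y} → x ∉ P → y ∉ P → x ∈ Q → y ∈ Q → x ≢ y →
              2 + ∣ P ∩ Q ∣ ≤ ∣ Q ∣
  size-∩-<₂ {P} {Q} x∉P y∉P x∈Q y∈Q x≢y = begin
    2 + ∣ P ∩ Q ∣          ≡⟨ cong (2 +_) (size-∩-comm P Q) ⟩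
    2 + ∣ Q ∩ P ∣          ≡⟨ +-comm 2 _ ⟩
    ∣ Q ∩ P ∣ + 2          ≤⟨ +-monoʳ-≤ _ (size-≥2 x∈Q∖P y∈Q∖P x≢y) ⟩
    ∣ Q ∩ P ∣ + ∣ Q ∖ P ∣  ≡⟨ size-split Q P ⟨
    ∣ Q ∣                  ∎
    where
    open ≤-Reasoning
    x∈Q∖P = ∩⁺ x∈Q (∁⁺ x∉P)
    y∈Q∖P = ∩⁺ y∈Q (∁⁺ y∉P)

  size-∖-∁ : ∀ (P Q : Fin n → Bool) → ∣ P ∖ Q ∣ + ∣ ∁ P ∖ Q ∣ ≡ ∣ ∁ Q ∣
  size-∖-∁ P Q = begin
    ∣ P ∩ ∁ Q ∣ + ∣ ∁ P ∩ ∁ Q ∣  ≡⟨ cong₂ _+_ (size-∩-comm P (∁ Q)) (size-∩-comm (∁ P) (∁ Q)) ⟩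
    ∣ ∁ Q ∩ P ∣ + ∣ ∁ Q ∖ P ∣    ≡⟨ size-split (∁ Q) P ⟨
    ∣ ∁ Q ∣                      ∎
    where open ≡-Reasoning

4a<5k⇒2k<b : ∀ {a b} k → a + b ≡ 4 * k → 4 * a < 5 * k → 2 * k < b
4a<5k⇒2k<b {a} {b} k a+b≡4k 4a<5k = ≰⇒> λ b≤2k → n≮n (16 * k) (begin-strict
  16 * k               ≡⟨ solve (k ∷ []) ⟩
  4 * (4 * k)          ≡⟨ cong (4 *_) a+b≡4k ⟨
  4 * (a + b)          ≡⟨ *-distribˡ-+ 4 a b ⟩
  4 * a + 4 * b        <⟨ +-monoˡ-< (4 * b) 4a<5k ⟩
  5 * k + 4 * b        ≤⟨ +-monoʳ-≤ (5 * k) (*-monoʳ-≤ 4 b≤2k) ⟩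
  5 * k + 4 * (2 * k)  ≡⟨ solve (k ∷ []) ⟩
  13 * k               ≤⟨ *-monoˡ-≤ k (m≤m+n 13 3) ⟩
  16 * k               ∎)
  where open ≤-Reasoning

o<m+n⇒n≤o⇒0<m : ∀ {m n o} → o < m + n → n ≤ o → 0 < m
o<m+n⇒n≤o⇒0<m {zero}  o<n n≤o = contradiction (<-≤-trans o<n n≤o) (n≮n _)
o<m+n⇒n≤o⇒0<m {suc m} _   _   = z<s

module _ {n} (G : Graph3 n) where

  edge-swap₁₂ : ∀ {x y z} → z ∈ edge G x y → z ∈ edge G y x
  edge-swap₁₂ {x} {y} {z} (≡true⇒∈ xyz) = ≡true⇒∈ (trans (sym (sym₁₂ G x y z)) xyz)

  edge-swap₂₃ : ∀ {x y z} → z ∈ edge G x y → y ∈ edge G x z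
  edge-swap₂₃ {x} {y} {z} (≡true⇒∈ xyz) = ≡true⇒∈ (trans (sym (sym₂₃ G x y z)) xyz)

  edge-rotate : ∀ {x y z} → z ∈ edge G x y → x ∈ edge G y z
  edge-rotate xyz = edge-swap₂₃ (edge-swap₁₂ xyz)

  edge-distinct : ∀ {x y z} → z ∈ edge G x y → (x ≢ y) × (y ≢ z) × (x ≢ z)
  edge-distinct {x} {y} {z} xyz = distinct G x y z (∈⇒≡true xyz)

  ∉-edge₁ : ∀ {x y} → x ∉ edge G x y
  ∉-edge₁ xyx = proj₂ (proj₂ (edge-distinct xyx)) refl

  ∉-edge₂ : ∀ {x y} → y ∉ edge G x y
  ∉-edge₂ xyy = proj₁ (proj₂ (edge-distinct xyy)) refl

  edges⇒IsK4 : ∀ {a b c d} → c ∈ edge G a b → d ∈ edge G a b →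
               d ∈ edge G a c → d ∈ edge G b c → IsK4 G a b c d
  edges⇒IsK4 abc abd acd bcd =
    let a≢b , b≢c , a≢c = edge-distinct abc
        _   , b≢d , a≢d = edge-distinct abd
        _   , c≢d , _   = edge-distinct acd
    in a≢b , a≢c , a≢d , b≢c , b≢d , c≢d ,
       ∈⇒≡true abc , ∈⇒≡true abd , ∈⇒≡true acd , ∈⇒≡true bcd

module _ {n} {A : Fin n → Bool} {a b c d : Fin n} where

  odd-one-in-A : a ∉ A → b ∉ A → c ∉ A → d ∈ A →
                 Odd (count4 A a b c d) × Odd (count4B A a b c d)
  odd-one-in-A a∉A b∉A c∉A (≡true⇒∈ d∈A)
    rewrite ∉⇒≡false a∉A | ∉⇒≡false b∉A | ∉⇒≡false c∉A | d∈A = (0 , refl) , (1 , refl)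

  odd-one-in-B : a ∈ A → b ∈ A → c ∈ A → d ∉ A →
                 Odd (count4 A a b c d) × Odd (count4B A a b c d)
  odd-one-in-B (≡true⇒∈ a∈A) (≡true⇒∈ b∈A) (≡true⇒∈ c∈A) d∉A
    rewrite a∈A | b∈A | c∈A | ∉⇒≡false d∉A = (1 , refl) , (0 , refl)

module WithoutOddK4
  {n} (G : Graph3 n) (A : Fin n → Bool) (k m : ℕ)
  (n≡4k : n ≡ 4 * k) (3k≤1+m : 3 * k ≤ suc m) (m≤δG : m ≤δ G)
  (0<∣A∣ : 0 < ∣ A ∣) (4∣A∣<5k : 4 * ∣ A ∣ < 5 * k)
  (no-odd-K4 : ∀ a b c d → IsK4 G a b c d → Odd (count4 A a b c d) → Odd (count4B A a b c d) → ⊥)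
  where

  B : Fin n → Bool
  B = ∁ A

  N : Fin n → Fin n → Fin n → Bool
  N = edge G

  private variable
    w x x′ y z v : Fin n
    R : Fin n → Bool

  NoK4Extension : Fin n → Fin n → Fin n → (Fin n → Bool) → Set
  NoK4Extension p q w R = ∀ {v} → v ∈ R → v ∈ N p q → v ∈ N p w → v ∉ N q w

  ¬K4-one-in-A : x ∉ A → y ∉ A → z ∉ A → v ∈ A → ¬ IsK4 G x y z v
  ¬K4-one-in-A x∉A y∉A z∉A v∈A K = let odd , oddᴮ = odd-one-in-A x∉A y∉A z∉A v∈A in
    no-odd-K4 _ _ _ _ K odd oddᴮ

  ¬K4-one-in-B : x ∈ A → y ∈ A → z ∈ A → v ∉ A → ¬ IsK4 G x y z v
  ¬K4-one-in-B x∈A y∈A z∈A v∉A K = let odd , oddᴮ = odd-one-in-B x∈A y∈A z∈A v∉A in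
    no-odd-K4 _ _ _ _ K odd oddᴮ

  A⇒∉B : x ∈ A → x ∉ B
  A⇒∉B x∈A x∈B = ∁⁻ x∈B x∈A

  A≢B : x ∈ A → y ∈ B → x ≢ y
  A≢B x∈A x∈B refl = A⇒∉B x∈A x∈B

  ∣A∣+∣B∣≡4k : ∣ A ∣ + ∣ B ∣ ≡ 4 * k
  ∣A∣+∣B∣≡4k = trans (size-complement A) n≡4k

  2k<∣B∣ : 2 * k < ∣ B ∣
  2k<∣B∣ = 4a<5k⇒2k<b k ∣A∣+∣B∣≡4k 4∣A∣<5k

  codegree-bound : x ≢ y → m ≤ ∣ N x y ∣
  codegree-bound {x} {y} x≢y = subst (m ≤_) (size≡∣∣ (N x y)) (m≤δG x y x≢y)

  non-link-bound : x ≢ y → ∣ ∁ (N x y) ∣ ≤ suc k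
  non-link-bound {x} {y} x≢y = +-cancelʳ-≤ (3 * k) (∣ ∁ (N x y) ∣) (suc k) (begin
    ∣ ∁ (N x y) ∣ + 3 * k            ≤⟨ +-monoʳ-≤ (∣ ∁ (N x y) ∣) 3k≤1+∣Nxy∣ ⟩
    ∣ ∁ (N x y) ∣ + suc ∣ N x y ∣    ≡⟨ +-suc (∣ ∁ (N x y) ∣) (∣ N x y ∣) ⟩
    suc (∣ ∁ (N x y) ∣ + ∣ N x y ∣)  ≡⟨ cong suc (+-comm (∣ ∁ (N x y) ∣) (∣ N x y ∣)) ⟩
    suc (∣ N x y ∣ + ∣ ∁ (N x y) ∣)  ≡⟨ cong suc (trans (size-complement (N x y)) n≡4k) ⟩
    suc k + 3 * k                    ∎)
    where
    open ≤-Reasoning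
    3k≤1+∣Nxy∣ = ≤-trans 3k≤1+m (s≤s (codegree-bound x≢y))

  ∖-link-≤ : x ≢ y → x ∉ R → ∣ R ∖ N x y ∣ ≤ k
  ∖-link-≤ x≢y x∉R =
    s≤s⁻¹ (<-≤-trans (size-∩-< x∉R (∁⁺ (∉-edge₁ G))) (non-link-bound x≢y))

  ∖-link-< : x ≢ y → x ∉ R → y ∉ R → ∣ R ∖ N x y ∣ < k
  ∖-link-< x≢y x∉R y∉R =
    s≤s⁻¹ (≤-trans (size-∩-<₂ x∉R y∉R (∁⁺ (∉-edge₁ G)) (∁⁺ (∉-edge₂ G)) x≢y)
                   (non-link-bound x≢y))

  link∩link-< : ∀ {p q w R} → w ∈ N p q → NoK4Extension p q w R →
                ∣ N p q ∩ R ∩ N p w ∣ < k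
  link∩link-< {p} {q} {w} {R} w∈Npq no-ext = begin-strict
    ∣ S ∣          ≤⟨ size-mono S⊆S∖Nqw ⟩
    ∣ S ∖ N q w ∣  <⟨ ∖-link-< q≢w q∉S w∉S ⟩
    k              ∎
    where
    open ≤-Reasoning
    S = N p q ∩ R ∩ N p w
    S⊆S∖Nqw : S ⊆ S ∖ N q w
    S⊆S∖Nqw v∈S = ∩⁺ v∈S (∁⁺ (no-ext (∩⁻ʳ (∩⁻ˡ v∈S)) (∩⁻ˡ (∩⁻ˡ v∈S)) (∩⁻ʳ v∈S)))
    q≢w = proj₁ (proj₂ (edge-distinct G w∈Npq))
    q∉S : q ∉ S
    q∉S q∈S = ∉-edge₂ G (∩⁻ˡ (∩⁻ˡ q∈S))
    w∉S : w ∉ S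
    w∉S w∈S = ∉-edge₂ G (∩⁻ʳ w∈S)

  link-bound : ∀ {p q w R} → w ∈ N p q → NoK4Extension p q w R → ∣ N p q ∩ R ∣ < 2 * k
  link-bound {p} {q} {w} {R} w∈Npq no-ext = begin-strict
    ∣ R′ ∣                              ≡⟨ size-split R′ (N p w) ⟩
    ∣ R′ ∩ N p w ∣ + ∣ R′ ∖ N p w ∣     <⟨ +-mono-<-≤ (link∩link-< w∈Npq no-ext)
                                                       (∖-link-≤ p≢w p∉R′) ⟩
    k + k                               ≡⟨ cong (k +_) (+-identityʳ k) ⟨
    2 * k                               ∎
    where
    open ≤-Reasoning
    R′ = N p q ∩ R
    p≢w = proj₂ (proj₂ (edge-distinct G w∈Npq))
    p∉R′ : p ∉ R′
    p∉R′ p∈R′ = ∉-edge₁ G (∩⁻ˡ p∈R′)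

  link-bound-strict : ∀ {p q w R} → w ∈ N p q → NoK4Extension p q w R → w ∉ R →
                      2 + ∣ N p q ∩ R ∣ ≤ 2 * k
  link-bound-strict {p} {q} {w} {R} w∈Npq no-ext w∉R = begin
    2 + ∣ R′ ∣                               ≡⟨ cong (2 +_) (size-split R′ (N p w)) ⟩
    2 + (∣ R′ ∩ N p w ∣ + ∣ R′ ∖ N p w ∣)    ≡⟨ cong suc (+-suc _ _) ⟨
    suc ∣ R′ ∩ N p w ∣ + suc ∣ R′ ∖ N p w ∣  ≤⟨ +-mono-≤ (link∩link-< w∈Npq no-ext)
                                                          (∖-link-< p≢w p∉R′ w∉R′) ⟩
    k + k                                    ≡⟨ cong (k +_) (+-identityʳ k) ⟨
    2 * k                                    ∎
    where
    open ≤-Reasoning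
    R′ = N p q ∩ R
    p≢w = proj₂ (proj₂ (edge-distinct G w∈Npq))
    p∉R′ : p ∉ R′
    p∉R′ p∈R′ = ∉-edge₁ G (∩⁻ˡ p∈R′)
    w∉R′ : w ∉ R′
    w∉R′ w∈R′ = w∉R (∩⁻ʳ w∈R′)

  codegree-split : x ≢ y → 3 * k ≤ suc (∣ N x y ∩ A ∣ + ∣ N x y ∩ B ∣)
  codegree-split {x} {y} x≢y = ≤-trans 3k≤1+m (s≤s (begin
    m                              ≤⟨ codegree-bound x≢y ⟩
    ∣ N x y ∣                      ≡⟨ size-split (N x y) A ⟩
    ∣ N x y ∩ A ∣ + ∣ N x y ∩ B ∣  ∎))
    where open ≤-Reasoning

  A-link-lower-bound : ∀ e → x ≢ y → suc (e + ∣ N x y ∩ B ∣) ≤ 2 * k →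
                       e + k ≤ ∣ N x y ∩ A ∣
  A-link-lower-bound e x≢y = add-bounds (codegree-split x≢y)
    where
    add-bounds : ∀ {α β} → 3 * k ≤ suc (α + β) → suc (e + β) ≤ 2 * k → e + k ≤ α
    add-bounds {α} {β} 3k≤1+α+β 1+e+β≤2k = +-cancelʳ-≤ β (e + k) α (s≤s⁻¹ (begin
      suc (e + k + β)  ≡⟨ solve (e ∷ k ∷ β ∷ []) ⟩
      k + suc (e + β)  ≤⟨ +-monoʳ-≤ k 1+e+β≤2k ⟩
      3 * k            ≤⟨ 3k≤1+α+β ⟩
      suc (α + β)      ∎))
      where open ≤-Reasoning

  0<k : 0 < k
  0<k = *-cancelˡ-< 5 0 k (≤-<-trans z≤n 4∣A∣<5k)

  crossing-B-link-nonempty : x ∈ A → y ∈ B → ∃ (_∈ N x y ∩ B)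
  crossing-B-link-nonempty {x} {y} x∈A y∈B =
    let w , w∈B∩Nxy = size-witness 0<∣B∩Nxy∣ in w , ∩-comm-⊆ w∈B∩Nxy
    where
    0<∣B∩Nxy∣ : 0 < ∣ B ∩ N x y ∣
    0<∣B∩Nxy∣ = o<m+n⇒n≤o⇒0<m k<∣B∣ (∖-link-≤ (A≢B x∈A y∈B) (A⇒∉B x∈A))
      where
      k<∣B∣ : k < ∣ B ∩ N x y ∣ + ∣ B ∖ N x y ∣
      k<∣B∣ = subst (k <_) (size-split B (N x y)) (≤-<-trans (m≤m+n k _) 2k<∣B∣)

  crossing-B-link-bound : x ∈ A → y ∈ B → ∣ N x y ∩ B ∣ < 2 * k
  crossing-B-link-bound x∈A y∈B =
    let w , w∈Nxy∩B = crossing-B-link-nonempty x∈A y∈B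
        w∈B = ∩⁻ʳ w∈Nxy∩B
        w∈Nxy = ∩⁻ˡ w∈Nxy∩B
    in link-bound w∈Nxy λ v∈B v∈Nxy v∈Nxw v∈Nyw →
         ¬K4-one-in-A (∁⁻ y∈B) (∁⁻ w∈B) (∁⁻ v∈B) x∈A
           (edges⇒IsK4 G v∈Nyw (edge-rotate G w∈Nxy) (edge-rotate G v∈Nxy) (edge-rotate G v∈Nxw))

  crossing-A-link-bound : x ∈ A → y ∈ B → k ≤ ∣ N x y ∩ A ∣
  crossing-A-link-bound x∈A y∈B =
    A-link-lower-bound 0 (A≢B x∈A y∈B) (crossing-B-link-bound x∈A y∈B)

  crossing-A-link-nonempty : x ∈ A → y ∈ B → ∃ (_∈ N x y ∩ A)
  crossing-A-link-nonempty x∈A y∈B = size-witness (<-≤-trans 0<k (crossing-A-link-bound x∈A y∈B))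

  AAB-edge⇒A∖link-large : x ∈ A → x′ ∈ A → y ∈ B → x′ ∈ N x y →
                          2 * k + 2 ≤ ∣ A ∣ + ∣ A ∖ N x x′ ∣
  AAB-edge⇒A∖link-large {x} {x′} {y} x∈A x′∈A y∈B x′∈Nxy =
    add-bounds k≤∣T∩Nxx′∣+∣T∖Nxx′∣ ∣T∩Nxx′∣<∣A∖Nx′y∣ ∣A∖Nx′y∣+k≤∣A∣
               ∣T∖Nxx′∣<∣A∖Nxx′∣
    where
    T = N x y ∩ A
    no-ext : NoK4Extension x x′ y A
    no-ext v∈A v∈Nxx′ v∈Nxy v∈Nx′y = ¬K4-one-in-B x∈A x′∈A v∈A (∁⁻ y∈B)
      (edges⇒IsK4 G v∈Nxx′ (edge-swap₂₃ G x′∈Nxy) (edge-swap₂₃ G v∈Nxy) (edge-swap₂₃ G v∈Nx′y))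
    k≤∣T∩Nxx′∣+∣T∖Nxx′∣ : k ≤ ∣ T ∩ N x x′ ∣ + ∣ T ∖ N x x′ ∣
    k≤∣T∩Nxx′∣+∣T∖Nxx′∣ = subst (k ≤_) (size-split T (N x x′)) (crossing-A-link-bound x∈A y∈B)
    T∩Nxx′⊆ : T ∩ N x x′ ⊆ N x x′ ∩ (A ∖ N x′ y)
    T∩Nxx′⊆ v∈ = let v∈A = ∩⁻ʳ (∩⁻ˡ v∈); v∈Nxx′ = ∩⁻ʳ v∈ in
      ∩⁺ v∈Nxx′ (∩⁺ v∈A (∁⁺ (no-ext v∈A v∈Nxx′ (∩⁻ˡ (∩⁻ˡ v∈)))))
    ∣T∩Nxx′∣<∣A∖Nx′y∣ : ∣ T ∩ N x x′ ∣ < ∣ A ∖ N x′ y ∣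
    ∣T∩Nxx′∣<∣A∖Nx′y∣ =
      ≤-<-trans (size-mono T∩Nxx′⊆) (size-∩-< (∉-edge₂ G) (∩⁺ x′∈A (∁⁺ (∉-edge₁ G))))
    T∖Nxx′⊆ : T ∖ N x x′ ⊆ N x y ∩ (A ∖ N x x′)
    T∖Nxx′⊆ v∈ = ∩⁺ (∩⁻ˡ (∩⁻ˡ v∈)) (∩⁺ (∩⁻ʳ (∩⁻ˡ v∈)) (∩⁻ʳ v∈))
    ∣T∖Nxx′∣<∣A∖Nxx′∣ : ∣ T ∖ N x x′ ∣ < ∣ A ∖ N x x′ ∣
    ∣T∖Nxx′∣<∣A∖Nxx′∣ =
      ≤-<-trans (size-mono T∖Nxx′⊆) (size-∩-< (∉-edge₁ G) (∩⁺ x∈A (∁⁺ (∉-edge₁ G))))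
    ∣A∖Nx′y∣+k≤∣A∣ : ∣ A ∖ N x′ y ∣ + k ≤ ∣ A ∣
    ∣A∖Nx′y∣+k≤∣A∣ = begin
      ∣ A ∖ N x′ y ∣ + k               ≤⟨ +-monoʳ-≤ (∣ A ∖ N x′ y ∣) (crossing-A-link-bound x′∈A y∈B) ⟩
      ∣ A ∖ N x′ y ∣ + ∣ N x′ y ∩ A ∣  ≡⟨ cong (∣ A ∖ N x′ y ∣ +_) (size-∩-comm (N x′ y) A) ⟩
      ∣ A ∖ N x′ y ∣ + ∣ A ∩ N x′ y ∣  ≡⟨ +-comm (∣ A ∖ N x′ y ∣) (∣ A ∩ N x′ y ∣) ⟩
      ∣ A ∩ N x′ y ∣ + ∣ A ∖ N x′ y ∣  ≡⟨ size-split A (N x′ y) ⟨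
      ∣ A ∣                            ∎
      where open ≤-Reasoning
    add-bounds : ∀ {t₁ t₂ u a c} → k ≤ t₁ + t₂ → t₁ < u → u + k ≤ a → t₂ < c →
                 2 * k + 2 ≤ a + c
    add-bounds {t₁} {t₂} {u} {a} {c} k≤t₁+t₂ t₁<u u+k≤a t₂<c = begin
      2 * k + 2              ≡⟨ solve (k ∷ []) ⟩
      k + k + 2              ≤⟨ +-monoˡ-≤ 2 (+-monoʳ-≤ k k≤t₁+t₂) ⟩
      k + (t₁ + t₂) + 2      ≡⟨ solve (k ∷ t₁ ∷ t₂ ∷ []) ⟩
      (suc t₁ + k) + suc t₂  ≤⟨ +-mono-≤ (+-monoˡ-≤ k t₁<u) t₂<c ⟩
      (u + k) + c            ≤⟨ +-monoˡ-≤ c u+k≤a ⟩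
      a + c                  ∎
      where open ≤-Reasoning

  AAA-edge⇒B-small : x ∈ A → x′ ∈ A → w ∈ A → w ∈ N x x′ →
                     suc (∣ B ∣ + ∣ A ∖ N x x′ ∣) ≤ 3 * k
  AAA-edge⇒B-small {x} {x′} {w} x∈A x′∈A w∈A w∈Nxx′ =
    add-bounds ∣B∣≡∣Nxx′∩B∣+∣B∖Nxx′∣ 2+∣Nxx′∩B∣≤2k
               ∣A∖Nxx′∣+∣B∖Nxx′∣≤1+k
    where
    ∣B∣≡∣Nxx′∩B∣+∣B∖Nxx′∣ : ∣ B ∣ ≡ ∣ N x x′ ∩ B ∣ + ∣ B ∖ N x x′ ∣
    ∣B∣≡∣Nxx′∩B∣+∣B∖Nxx′∣ =
      trans (size-split B (N x x′)) (cong (_+ ∣ B ∖ N x x′ ∣) (size-∩-comm B (N x x′)))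
    no-ext : NoK4Extension x x′ w B
    no-ext v∈B v∈Nxx′ v∈Nxw v∈Nx′w =
      ¬K4-one-in-B x∈A x′∈A w∈A (∁⁻ v∈B) (edges⇒IsK4 G w∈Nxx′ v∈Nxx′ v∈Nxw v∈Nx′w)
    2+∣Nxx′∩B∣≤2k : 2 + ∣ N x x′ ∩ B ∣ ≤ 2 * k
    2+∣Nxx′∩B∣≤2k = link-bound-strict w∈Nxx′ no-ext (A⇒∉B w∈A)
    ∣A∖Nxx′∣+∣B∖Nxx′∣≤1+k : ∣ A ∖ N x x′ ∣ + ∣ B ∖ N x x′ ∣ ≤ suc k
    ∣A∖Nxx′∣+∣B∖Nxx′∣≤1+k = ≤-trans (≤-reflexive (size-∖-∁ A (N x x′)))
                                    (non-link-bound (proj₁ (edge-distinct G w∈Nxx′)))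
    add-bounds : ∀ {b β β′ c} → b ≡ β + β′ → 2 + β ≤ 2 * k → c + β′ ≤ suc k →
                 suc (b + c) ≤ 3 * k
    add-bounds {b} {β} {β′} {c} b≡β+β′ 2+β≤2k c+β′≤1+k = s≤s⁻¹ (begin
      2 + (b + c)         ≡⟨ cong (λ b → 2 + (b + c)) b≡β+β′ ⟩
      2 + (β + β′ + c)    ≡⟨ solve (β ∷ β′ ∷ c ∷ []) ⟩
      (2 + β) + (c + β′)  ≤⟨ +-mono-≤ 2+β≤2k c+β′≤1+k ⟩
      2 * k + suc k       ≡⟨ solve (k ∷ []) ⟩
      suc (3 * k)         ∎)
      where open ≤-Reasoning

  AAB-edge⇒no-AAA-edge : x ∈ A → x′ ∈ A → y ∈ B → x′ ∈ N x y → w ∈ A → w ∉ N x x′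
  AAB-edge⇒no-AAA-edge {x} {x′} x∈A x′∈A y∈B x′∈Nxy w∈A w∈Nxx′ =
    incompatible {∣ A ∣} {∣ B ∣} {∣ A ∖ N x x′ ∣} ∣A∣+∣B∣≡4k 4∣A∣<5k
      (AAB-edge⇒A∖link-large x∈A x′∈A y∈B x′∈Nxy) (AAA-edge⇒B-small x∈A x′∈A w∈A w∈Nxx′)
    where
    -- Twice the last two hypotheses, twice the first and the second add up to k + 7 ≤ 0.
    incompatible : ∀ {a b c} → a + b ≡ 4 * k → 4 * a < 5 * k → 2 * k + 2 ≤ a + c →
                   suc (b + c) ≤ 3 * k → ⊥
    incompatible {a} {b} {c} a+b≡4k 4a<5k 2k+2≤a+c 1+b+c≤3k =
      contradiction (+-cancelʳ-≤ (4 * a + 2 * b + 2 * c + 11 * k) (suc (k + 6)) 0 (begin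
        suc (k + 6) + (4 * a + 2 * b + 2 * c + 11 * k)                  ≡⟨ solve (a ∷ b ∷ c ∷ k ∷ []) ⟩
        2 * (2 * k + 2) + 2 * suc (b + c) + 2 * (4 * k) + suc (4 * a)  ≤⟨ sum ⟩
        2 * (a + c) + 2 * (3 * k) + 2 * (a + b) + 5 * k                 ≡⟨ solve (a ∷ b ∷ c ∷ k ∷ []) ⟩
        0 + (4 * a + 2 * b + 2 * c + 11 * k)                            ∎)) λ ()
      where
      open ≤-Reasoning
      sum = +-mono-≤ (+-mono-≤ (+-mono-≤ (*-monoʳ-≤ 2 2k+2≤a+c) (*-monoʳ-≤ 2 1+b+c≤3k))
                               (≤-reflexive (cong (2 *_) (sym a+b≡4k))))
                     4a<5k

  ∃A : ∃ (_∈ A)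
  ∃A = size-witness 0<∣A∣

  ∃B : ∃ (_∈ B)
  ∃B = size-witness (≤-<-trans z≤n 2k<∣B∣)

  ∣A∣≤1+k : ∣ A ∣ ≤ suc k
  ∣A∣≤1+k =
    let x , x∈A = ∃A
        y , y∈B = ∃B
        x′ , x′∈Nxy∩A = crossing-A-link-nonempty x∈A y∈B
        x′∈Nxy = ∩⁻ˡ x′∈Nxy∩A
        A⊆∁Nxx′ : A ⊆ ∁ (N x x′)
        A⊆∁Nxx′ = λ w∈A → ∁⁺ (AAB-edge⇒no-AAA-edge x∈A (∩⁻ʳ x′∈Nxy∩A) y∈B x′∈Nxy w∈A)
    in ≤-trans (size-mono A⊆∁Nxx′) (non-link-bound (proj₂ (proj₂ (edge-distinct G x′∈Nxy))))

  ∣B∣<3k : x ∈ A → y ∈ B → ∣ B ∣ < 3 * k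
  ∣B∣<3k {x} {y} x∈A y∈B = begin-strict
    ∣ B ∣                          ≡⟨ size-split B (N x y) ⟩
    ∣ B ∩ N x y ∣ + ∣ B ∖ N x y ∣  ≡⟨ cong (_+ ∣ B ∖ N x y ∣) (size-∩-comm B (N x y)) ⟩
    ∣ N x y ∩ B ∣ + ∣ B ∖ N x y ∣  <⟨ +-mono-<-≤ (crossing-B-link-bound x∈A y∈B) ∣B∖Nxy∣≤k ⟩
    2 * k + k                      ≡⟨ +-comm (2 * k) k ⟩
    3 * k                          ∎
    where
    open ≤-Reasoning
    ∣B∖Nxy∣≤k = ∖-link-≤ (A≢B x∈A y∈B) (A⇒∉B x∈A)

  crossing-non-link-B-≥2 : x ∈ A → y ∈ B → 2 ≤ ∣ B ∖ N x y ∣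
  crossing-non-link-B-≥2 {x} {y} x∈A y∈B = +-cancelˡ-≤ (∣ B ∩ N x y ∣) 2 (∣ B ∖ N x y ∣) (begin
    ∣ B ∩ N x y ∣ + 2              ≡⟨ +-suc (∣ B ∩ N x y ∣) 1 ⟩
    suc ∣ B ∩ N x y ∣ + 1          ≤⟨ +-monoˡ-≤ 1 ∣B∩Nxy∣<2k ⟩
    2 * k + 1                      ≡⟨ +-comm (2 * k) 1 ⟩
    suc (2 * k)                    ≤⟨ 2k<∣B∣ ⟩
    ∣ B ∣                          ≡⟨ size-split B (N x y) ⟩
    ∣ B ∩ N x y ∣ + ∣ B ∖ N x y ∣  ∎)
    where
    open ≤-Reasoning
    ∣B∩Nxy∣<2k = subst (_< 2 * k) (size-∩-comm (N x y) B) (crossing-B-link-bound x∈A y∈B)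

  BB-link-meets-A : y ∈ B → z ∈ B → y ≢ z → ∃ (_∈ N y z ∩ A)
  BB-link-meets-A {y} {z} y∈B z∈B y≢z =
    size-witness (≤-trans (s≤s z≤n) (+-cancelʳ-≤ (∣ N y z ∩ B ∣) 2 (∣ N y z ∩ A ∣) (s≤s⁻¹ (begin
      3 + ∣ N y z ∩ B ∣                    ≤⟨ s≤s (size-∩-<₂ (∉-edge₁ G) (∉-edge₂ G) y∈B z∈B y≢z) ⟩
      suc ∣ B ∣                            ≤⟨ ∣B∣<3k (proj₂ ∃A) y∈B ⟩
      3 * k                                ≤⟨ codegree-split y≢z ⟩
      suc (∣ N y z ∩ A ∣ + ∣ N y z ∩ B ∣)  ∎))))
    where open ≤-Reasoning

  BB-link-A-large : y ∈ B → z ∈ B → v ∈ A → v ∈ N y z → suc k ≤ ∣ N y z ∩ A ∣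
  BB-link-A-large {y} {z} {v} y∈B z∈B v∈A v∈Nyz =
    A-link-lower-bound 1 (proj₁ (edge-distinct G v∈Nyz)) (link-bound-strict v∈Nyz no-ext (A⇒∉B v∈A))
    where
    no-ext : NoK4Extension y z v B
    no-ext u∈B u∈Nyz u∈Nyv u∈Nzv = ¬K4-one-in-A (∁⁻ y∈B) (∁⁻ z∈B) (∁⁻ u∈B) v∈A
      (edges⇒IsK4 G u∈Nyz v∈Nyz (edge-swap₂₃ G u∈Nyv) (edge-swap₂₃ G u∈Nzv))

  impossible : ⊥
  impossible =
    let x , x∈A = ∃A
        y , y∈B = ∃B
        z , z∈B∖Nxy , y≢z = size-≥2⇒other y (crossing-non-link-B-≥2 x∈A y∈B)
        z∈B = ∩⁻ˡ z∈B∖Nxy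
        x∉Nyz = λ x∈Nyz → ∁⁻ (∩⁻ʳ z∈B∖Nxy) (edge-rotate G (edge-rotate G x∈Nyz))
        v , v∈Nyz∩A = BB-link-meets-A y∈B z∈B y≢z
    in n≮n (suc k) (begin-strict
      suc k          ≤⟨ BB-link-A-large y∈B z∈B (∩⁻ʳ v∈Nyz∩A) (∩⁻ˡ v∈Nyz∩A) ⟩
      ∣ N y z ∩ A ∣  <⟨ size-∩-< x∉Nyz x∈A ⟩
      ∣ A ∣          ≤⟨ ∣A∣≤1+k ⟩
      suc k          ∎)
    where open ≤-Reasoning

odd? : ∀ k → Dec (Odd k)
odd? zero          = no λ ()
odd? (suc zero)    = yes (0 , refl)
odd? (suc (suc k)) = map′ odd-2+ odd-2+⁻¹ (odd? k)
  where
  odd-2+ : Odd k → Odd (2 + k)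
  odd-2+ (j , k≡1+2j) = suc j , trans (cong (2 +_) k≡1+2j) (cong suc (sym (*-suc 2 j)))
  odd-2+⁻¹ : Odd (2 + k) → Odd k
  odd-2+⁻¹ (zero  , ())
  odd-2+⁻¹ (suc j , 2+k≡1+2[1+j]) =
    j , suc-injective (suc-injective (trans 2+k≡1+2[1+j] (cong suc (*-suc 2 j))))

odd-K4? : ∀ {n} (G : Graph3 n) (A : Fin n → Bool) a b c d →
          Dec (IsK4 G a b c d × Odd (count4 A a b c d) × Odd (count4B A a b c d))
odd-K4? G A a b c d =
  (¬? (a ≟ b) ×-dec ¬? (a ≟ c) ×-dec ¬? (a ≟ d) ×-dec ¬? (b ≟ c) ×-dec ¬? (b ≟ d) ×-dec ¬? (c ≟ d)
   ×-dec edge G a b c Bool.≟ true ×-dec edge G a b d Bool.≟ true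
   ×-dec edge G a c d Bool.≟ true ×-dec edge G b c d Bool.≟ true)
  ×-dec odd? (count4 A a b c d) ×-dec odd? (count4B A a b c d)

-- The conclusion is decidable, so it suffices to refute its failure for every quadruple.
lemma8p10 : (n : ℕ) → 4 ∣ n → (G : Graph3 n) → (m : ℕ) → m ≤δ G → 3 * n ≤ 4 * (m + 1) →
    (A : Fin n → Bool) → 3 * n < 16 * size A → 16 * size A < 5 * n →
    ∃ λ a → ∃ λ b → ∃ λ c → ∃ λ d →
      IsK4 G a b c d × Odd (count4 A a b c d) × Odd (count4B A a b c d)
lemma8p10 .(k * 4) (divides k refl) G m m≤δG 3n≤4[m+1] A 3n<16∣A∣ 16∣A∣<5n
  with any? (λ a → any? (λ b → any? (λ c → any? (λ d → odd-K4? G A a b c d))))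
... | yes odd-K4 = odd-K4
... | no ¬odd-K4 = ⊥-elim (WithoutOddK4.impossible G A k m (*-comm k 4) 3k≤1+m m≤δG 0<∣A∣ 4∣A∣<5k
                     λ a b c d K odd oddᴮ → ¬odd-K4 (a , b , c , d , K , odd , oddᴮ))
  where
  3[4k]≡4[3k] : 3 * (k * 4) ≡ 4 * (3 * k)
  3[4k]≡4[3k] = solve (k ∷ [])
  5[4k]≡4[5k] : 5 * (k * 4) ≡ 4 * (5 * k)
  5[4k]≡4[5k] = solve (k ∷ [])
  16a≡4[4a] : ∀ a → 16 * a ≡ 4 * (4 * a)
  16a≡4[4a] = solve-∀
  3k≤1+m : 3 * k ≤ suc m
  3k≤1+m = *-cancelˡ-≤ 4 (subst₂ _≤_ 3[4k]≡4[3k] (cong (4 *_) (+-comm m 1)) 3n≤4[m+1])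
  0<∣A∣ : 0 < ∣ A ∣
  0<∣A∣ = *-cancelˡ-< 16 0 (∣ A ∣)
    (≤-<-trans z≤n (subst (3 * (k * 4) <_) (cong (16 *_) (size≡∣∣ A)) 3n<16∣A∣))
  4∣A∣<5k : 4 * ∣ A ∣ < 5 * k
  4∣A∣<5k = *-cancelˡ-< 4 (4 * ∣ A ∣) (5 * k)
    (subst₂ _<_ (trans (cong (16 *_) (size≡∣∣ A)) (16a≡4[4a] (∣ A ∣))) 5[4k]≡4[5k] 16∣A∣<5n)
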